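{- Consider the Static Black-Peg AB Game with $p=3$ pegs and $c\ge 5$ colors. Then: (a) If a feasible strategy contains two $(1,1,1)$-questions, then it contains no further question that is a $(\star,1,1)$-question, a $(1,\star,1)$-question or a $(1,1,\star)$-question. (b) A feasible strategy contains at most two $(1,1,1)$-questions. (c) If a feasible strategy contains a $(1,1,1)$-question and for each peg there is a color which does not occur on this peg, then the strategy contains no further question that is a $(\star,1,1)$-question, a $(1,\star,1)$-question or a $(1,1,\star)$-question. (d) A feasible strategy in which for each peg there is a color not occurring on this peg contains at most one $(1,1,1)$-question.
   Context: Static Black-Peg AB Game with $p$ pegs and $c\ge p$ colors $1,\dots,c$: secrets and questions are ordered $p$-tuples $(x_1\,|\,\dots\,|\,x_p)$ of pairwise distinct colors; the answer to question $Q$ for secret $S$ is the number of positions $i$ with $q_i=s_i$. A strategy is a list of pairwise distinct questions asked all at once; it is feasible if any two distinct secrets receive different vectors of answers. A color occurs on peg $i$ if it is the $i$-th entry of some question of the strategy. For a question $Q=(q_1|\dots|q_p)$ of a strategy, $Q$ is an $(a_1,\dots,a_p)$-question if for each $i$ the color $q_i$ occurs exactly $a_i$ times as the $i$-th entry among all questions of the strategy (including $Q$); an entry $\star$ in place of $a_i$ means no condition is imposed on peg $i$. -}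

module Defs where

open import Data.Nat using (ℕ; zero; suc)
open import Data.Fin using (Fin)
open import Data.Fin.Properties using () renaming (_≟_ to _≟ᶠ_)
open import Data.Vec using (Vec; lookup; []; _∷_)
open import Relation.Nullary using (yes; no)
open import Data.List using (List; length; filter)
open import Data.List.Membership.Propositional using (_∈_)
open import Data.List.Relation.Unary.Unique.Propositional using (Unique)
open import Data.List.Relation.Unary.All using (All)
open import Data.Maybe using (Maybe; just; nothing)
open import Data.Product using (_×_; ∃)
open import Relation.Binary.PropositionalEquality using (_≡_; _≢_)

-- Number of pegs is fixed to p; colors are Fin c (colors 1..c ↦ 0..c-1).
-- A p-tuple of colors (secret or question) with pairwise distinct entries.
Tuple : ℕ → ℕ → Set
Tuple p c = Vec (Fin c) p

PairwiseDistinct : ∀ {p c} → Tuple p c → Set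
PairwiseDistinct {p} T = ∀ (i j : Fin p) → i ≢ j → lookup T i ≢ lookup T j

answer : ∀ {p c} → Tuple p c → Tuple p c → ℕ
answer {zero}  [] [] = 0
answer {suc p} (q ∷ Q) (s ∷ S) with q ≟ᶠ s
... | yes _ = suc (answer Q S)
... | no  _ = answer Q S

record Strategy (p c : ℕ) : Set where
  field
    questions : List (Tuple p c)
    distinct  : Unique questions
    valid     : All PairwiseDistinct questions
open Strategy public

Feasible : ∀ {p c} → Strategy p c → Set
Feasible {p} {c} St =
  ∀ (S S' : Tuple p c) → PairwiseDistinct S → PairwiseDistinct S' →
  (∀ Q → Q ∈ questions St → answer Q S ≡ answer Q S') → S ≡ S'

occ : ∀ {p c} → Strategy p c → Fin p → Fin c → ℕ
occ St i x = length (filter (λ Q → lookup Q i ≟ᶠ x) (questions St))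

Occurs : ∀ {p c} → Strategy p c → Fin p → Fin c → Set
Occurs St i x = ∃ λ Q → Q ∈ questions St × lookup Q i ≡ x

-- Q is an (a_1,...,a_p)-question of the strategy, where an entry
-- 'nothing' stands for ⋆ (no condition) and 'just a' for a.
IsTypeQuestion : ∀ {p c} → Strategy p c → Vec (Maybe ℕ) p → Tuple p c → Set
IsTypeQuestion {p} St a Q =
  Q ∈ questions St ×
  (∀ (i : Fin p) (k : ℕ) → lookup a i ≡ just k → occ St i (lookup Q i) ≡ k)

{-# OPTIONS --safe #-}
-- A colour on a peg affects the answers only through the questions carrying it
-- there: a colour that only the question R has on that peg adds 1 to the answer
-- of R and nothing else, and a colour absent from the peg adds nothing.  Hence
-- two distinct secrets whose colours can be matched into such equally
-- contributing pairs get the same answers, contradicting feasibility.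
--
-- On the two pegs where the (⋆,1,1)-question Q is 1, the (1,1,1)-question A,
-- the question Q and either a second (1,1,1)-question B (part a) or the absent
-- colours (part c) give three columns of equally contributing colour pairs.
-- Either two columns can be swapped across these pegs, a fifth colour filling
-- the remaining peg, or their coincidences form a 3-cycle; then rotating the
-- rows of A and B, resp. a short case split on the absent colours, produces the
-- two confusable secrets.  Parts (b) and (d) follow since a (1,1,1)-question is
-- also a (⋆,1,1)-question.
module Submission where

open import Defs
open import Data.Nat using (ℕ; _≤_; _<_; _+_)
open import Data.Nat.Properties using (+-0-commutativeMonoid; ≤-trans; n≤1+n)
open import Algebra.Properties.CommutativeMonoid.Sum +-0-commutativeMonoid using (sum; sum-permute; sum-cong-≗)
open import Data.Fin using (Fin)
open import Data.Fin.Patterns using (0F; 1F; 2F)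
open import Data.Fin.Properties using (_≟_; pigeonhole; ¬∀⟶∃¬; <⇒≢)
open import Data.Fin.Permutation using (Permutation′; _⟨$⟩ʳ_; _⟨$⟩ˡ_; inverseˡ; inverseʳ; id; transpose; _∘ₚ_)
open import Data.Vec using (Vec; []; _∷_; lookup; tabulate; replicate)
open import Data.Vec.Properties using (lookup∘tabulate; tabulate∘lookup; tabulate-cong; lookup-replicate)
open import Data.Maybe using (just; nothing)
open import Data.Product using (_×_; _,_; ∃; proj₂; map₂)
open import Data.Sum using (_⊎_; inj₁; inj₂)
open import Data.Empty using (⊥)
open import Data.List using (List; []; _∷_; length)
import Data.List as List
open import Data.List.Membership.Propositional using (_∈_)
open import Data.List.Membership.Propositional.Properties using (∈-filter⁺)
import Data.List.Membership.DecPropositional as DecMembership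
open import Data.List.Relation.Unary.Any using (here; index)
open import Data.List.Relation.Unary.Any.Properties using (lookup-index)
open import Data.List.Relation.Unary.All as All using (All; []; _∷_)
open import Data.List.Relation.Unary.All.Properties using (¬Any⇒All¬)
open import Function using (_∘_; case_of_)
open import Relation.Nullary using (¬_; yes; no; contradiction)
open import Relation.Binary.Definitions using (DecidableEquality)
open import Relation.Binary.PropositionalEquality using (_≡_; _≢_; refl; sym; trans; cong; ≢-sym; module ≡-Reasoning)

hit : ∀ {c} → Fin c → Fin c → ℕ
hit q s with q ≟ s
... | yes _ = 1
... | no  _ = 0

answer-∷ : ∀ {p c} (q s : Fin c) (Q S : Tuple p c) → answer (q ∷ Q) (s ∷ S) ≡ hit q s + answer Q S
answer-∷ q s Q S with q ≟ s
... | yes _ = refl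
... | no  _ = refl

answer≡sum : ∀ {p c} (Q S : Tuple p c) → answer Q S ≡ sum (λ t → hit (lookup Q t) (lookup S t))
answer≡sum []      []      = refl
answer≡sum (q ∷ Q) (s ∷ S) = trans (answer-∷ q s Q S) (cong (hit q s +_) (answer≡sum Q S))

module _ {p} (π : Permutation′ p) where

  ⟨$⟩ʳ-injective : ∀ {t t'} → π ⟨$⟩ʳ t ≡ π ⟨$⟩ʳ t' → t ≡ t'
  ⟨$⟩ʳ-injective eq = trans (sym (inverseˡ π)) (trans (cong (π ⟨$⟩ˡ_) eq) (inverseˡ π))

  ⟨$⟩ˡ-injective : ∀ {t t'} → π ⟨$⟩ˡ t ≡ π ⟨$⟩ˡ t' → t ≡ t'
  ⟨$⟩ˡ-injective eq = trans (sym (inverseʳ π)) (trans (cong (π ⟨$⟩ʳ_) eq) (inverseʳ π))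

-- Entry t of s goes to peg π t.
place : ∀ {p c} → Permutation′ p → Vec (Fin c) p → Tuple p c
place π s = tabulate (lookup s ∘ (π ⟨$⟩ˡ_))

module _ {p c : ℕ} (π : Permutation′ p) where

  lookup-place : (s : Vec (Fin c) p) (t : Fin p) → lookup (place π s) (π ⟨$⟩ʳ t) ≡ lookup s t
  lookup-place s t = trans (lookup∘tabulate _ (π ⟨$⟩ʳ t)) (cong (lookup s) (inverseˡ π))

  place-injective : {s s' : Vec (Fin c) p} → place π s ≡ place π s' → s ≡ s'
  place-injective {s} {s'} eq = begin
    s                                           ≡⟨ unplace s ⟩
    tabulate (lookup (place π s) ∘ (π ⟨$⟩ʳ_))   ≡⟨ cong (λ S → tabulate (lookup S ∘ (π ⟨$⟩ʳ_))) eq ⟩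
    tabulate (lookup (place π s') ∘ (π ⟨$⟩ʳ_))  ≡⟨ unplace s' ⟨
    s'                                          ∎
    where
    open ≡-Reasoning
    unplace : (s : Vec (Fin c) p) → s ≡ tabulate (lookup (place π s) ∘ (π ⟨$⟩ʳ_))
    unplace s = trans (sym (tabulate∘lookup s)) (tabulate-cong (sym ∘ lookup-place s))

  place-distinct : (s : Vec (Fin c) p) → PairwiseDistinct s → PairwiseDistinct (place π s)
  place-distinct s s-distinct t t' t≢t' eq =
    s-distinct _ _ (t≢t' ∘ ⟨$⟩ˡ-injective π) (trans (sym (lookup∘tabulate _ t)) (trans eq (lookup∘tabulate _ t')))

  answer-place : (P : Tuple p c) (s : Vec (Fin c) p) →
                 answer P (place π s) ≡ sum (λ t → hit (lookup P (π ⟨$⟩ʳ t)) (lookup s t))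
  answer-place P s = begin
    answer P (place π s)                                                  ≡⟨ answer≡sum P (place π s) ⟩
    sum (λ t → hit (lookup P t) (lookup (place π s) t))                   ≡⟨ sum-permute _ π ⟩
    sum (λ t → hit (lookup P (π ⟨$⟩ʳ t)) (lookup (place π s) (π ⟨$⟩ʳ t))) ≡⟨ sum-cong-≗ (cong (hit _) ∘ lookup-place s) ⟩
    sum (λ t → hit (lookup P (π ⟨$⟩ʳ t)) (lookup s t))                    ∎
    where open ≡-Reasoning

module Contributions {p c} (St : Strategy p c) where

  Alike : Fin p → Fin c → Fin p → Fin c → Set
  Alike t x t' x' = ∀ {P} → P ∈ questions St → hit (lookup P t) x ≡ hit (lookup P t') x'

  alike-sym : ∀ {t t' x x'} → Alike t x t' x' → Alike t' x' t x
  alike-sym alike P∈ = sym (alike P∈)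

  alike-secrets-≡ : Feasible St → (π σ : Permutation′ p) {s s' : Vec (Fin c) p} →
    PairwiseDistinct s → PairwiseDistinct s' →
    (∀ t → Alike (π ⟨$⟩ʳ t) (lookup s t) (π ⟨$⟩ʳ (σ ⟨$⟩ʳ t)) (lookup s' (σ ⟨$⟩ʳ t))) → s ≡ s'
  alike-secrets-≡ feasible π σ {s} {s'} s-distinct s'-distinct alike =
    place-injective π (feasible _ _ (place-distinct π s s-distinct) (place-distinct π s' s'-distinct) same-answer)
    where
    open ≡-Reasoning
    same-answer : ∀ P → P ∈ questions St → answer P (place π s) ≡ answer P (place π s')
    same-answer P P∈ = begin
      answer P (place π s)                                                   ≡⟨ answer-place π P s ⟩
      sum (λ t → hit (lookup P (π ⟨$⟩ʳ t)) (lookup s t))                     ≡⟨ sum-cong-≗ (λ t → alike t P∈) ⟩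
      sum (λ t → hit (lookup P (π ⟨$⟩ʳ (σ ⟨$⟩ʳ t))) (lookup s' (σ ⟨$⟩ʳ t)))  ≡⟨ sum-permute _ σ ⟨
      sum (λ t → hit (lookup P (π ⟨$⟩ʳ t)) (lookup s' t))                    ≡⟨ answer-place π P s' ⟨
      answer P (place π s')                                                  ∎

  record Owns (t : Fin p) (x : Fin c) (R : Tuple p c) : Set where
    field
      member : R ∈ questions St
      colour : lookup R t ≡ x
      unique : ∀ {P} → P ∈ questions St → lookup P t ≡ x → P ≡ R
  open Owns

  OwnsRow : Tuple p c → Set
  OwnsRow R = ∀ t → Owns t (lookup R t) R

  owns-alike : ∀ {t t' x x' R} → Owns t x R → Owns t' x' R → Alike t x t' x'
  owns-alike {t} {t'} {x} {x'} o o' {P} P∈ with lookup P t ≟ x | lookup P t' ≟ x'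
  ... | yes _ | yes _ = refl
  ... | no  _ | no  _ = refl
  ... | yes e | no ne = contradiction (trans (cong (λ Q → lookup Q t') (unique o P∈ e)) (colour o')) ne
  ... | no ne | yes e = contradiction (trans (cong (λ Q → lookup Q t) (unique o' P∈ e)) (colour o)) ne

  absent-alike : ∀ {t t' x x'} → ¬ Occurs St t x → ¬ Occurs St t' x' → Alike t x t' x'
  absent-alike {t} {t'} {x} {x'} absent absent' {P} P∈ with lookup P t ≟ x | lookup P t' ≟ x'
  ... | no  _ | no  _ = refl
  ... | yes e | _     = contradiction (P , P∈ , e) absent
  ... | _     | yes e = contradiction (P , P∈ , e) absent'

  owners-≢ : ∀ {t x y R R'} → Owns t x R → Owns t y R' → R ≢ R' → x ≢ y
  owners-≢ o o' R≢R' refl = R≢R' (unique o' (member o) (colour o))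

  owned-≢-absent : ∀ {t x u R} → Owns t x R → ¬ Occurs St t u → x ≢ u
  owned-≢-absent o absent refl = absent (_ , member o , colour o)

  owned-row-≢ : ∀ {t t' x y R} → Owns t x R → Owns t' y R → t ≢ t' → x ≢ y
  owned-row-≢ o o' t≢t' refl = All.lookup (valid St) (member o) _ _ t≢t' (trans (colour o) (sym (colour o')))

  occ≡1⇒owns : ∀ {t R} → R ∈ questions St → occ St t (lookup R t) ≡ 1 → Owns t (lookup R t) R
  occ≡1⇒owns {t} {R} R∈ occ≡1 = record
    { member = R∈
    ; colour = refl
    ; unique = λ P∈ eq → singleton occ≡1 (∈-filter⁺ on-colour P∈ eq) (∈-filter⁺ on-colour R∈ refl)
    }
    where
    on-colour = λ (Q : Tuple p c) → lookup Q t ≟ lookup R t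
    singleton : ∀ {A : Set} {x y : A} {xs : List A} → length xs ≡ 1 → x ∈ xs → y ∈ xs → x ≡ y
    singleton {xs = _ ∷ []} _ (here refl) (here refl) = refl

  ones-question-owns-row : ∀ {R} → IsTypeQuestion St (replicate p (just 1)) R → OwnsRow R
  ones-question-owns-row (R∈ , occurrences) t = occ≡1⇒owns R∈ (occurrences t 1 (lookup-replicate t (just 1)))

fresh : ∀ {c} (xs : List (Fin c)) → length xs < c → ∃ λ z → All (z ≢_) xs
fresh {c} xs xs<c = map₂ (¬Any⇒All¬ xs) (¬∀⟶∃¬ c (_∈ xs) (_∈? xs) ¬covers)
  where
  open DecMembership (_≟_ {c}) using (_∈?_)
  ¬covers : ¬ (∀ z → z ∈ xs)
  ¬covers covers with pigeonhole xs<c (index ∘ covers)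
  ... | i , j , i<j , same-index = <⇒≢ i<j (begin
    i                                ≡⟨ lookup-index (covers i) ⟩
    List.lookup xs (index (covers i)) ≡⟨ cong (List.lookup xs) same-index ⟩
    List.lookup xs (index (covers j)) ≡⟨ lookup-index (covers j) ⟨
    j                                ∎)
    where open ≡-Reasoning

Swappable : ∀ {a} {A : Set a} → A × A → A × A → Set a
Swappable (x₁ , x₂) (y₁ , y₂) = x₁ ≢ y₂ × y₁ ≢ x₂

Cyclic : ∀ {a} {A : Set a} → A × A → A × A → A × A → Set a
Cyclic (x₁ , x₂) (y₁ , y₂) (z₁ , z₂) = x₁ ≡ y₂ × y₁ ≡ z₂ × z₁ ≡ x₂

swappable-or-cyclic : ∀ {a} {A : Set a} → DecidableEquality A → ∀ {x₁ x₂ y₁ y₂ z₁ z₂ : A} →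
  x₁ ≢ z₁ → y₁ ≢ z₁ → y₂ ≢ z₂ → x₁ ≢ x₂ →
  let X = x₁ , x₂ ; Y = y₁ , y₂ ; Z = z₁ , z₂ in
  Swappable X Y ⊎ Swappable X Z ⊎ Swappable Y Z ⊎ Cyclic X Y Z ⊎ Cyclic X Z Y
swappable-or-cyclic _≟_ {x₁} {x₂} {y₁} {y₂} {z₁} {z₂} x₁≢z₁ y₁≢z₁ y₂≢z₂ x₁≢x₂ with x₁ ≟ y₂
... | yes refl with y₁ ≟ z₂
...   | no y₁≢z₂ = inj₂ (inj₂ (inj₁ (y₁≢z₂ , ≢-sym x₁≢z₁)))
...   | yes refl with z₁ ≟ x₂
...     | yes refl = inj₂ (inj₂ (inj₂ (inj₁ (refl , refl , refl))))
...     | no z₁≢x₂ = inj₂ (inj₁ (y₂≢z₂ , z₁≢x₂))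
swappable-or-cyclic _≟_ {x₁} {x₂} {y₁} {y₂} {z₁} {z₂} x₁≢z₁ y₁≢z₁ y₂≢z₂ x₁≢x₂ | no x₁≢y₂ with y₁ ≟ x₂
... | no y₁≢x₂ = inj₁ (x₁≢y₂ , y₁≢x₂)
... | yes refl with x₁ ≟ z₂
...   | no x₁≢z₂ = inj₂ (inj₁ (x₁≢z₂ , ≢-sym y₁≢z₁))
...   | yes refl with z₁ ≟ y₂
...     | no z₁≢y₂ = inj₂ (inj₂ (inj₁ (≢-sym x₁≢x₂ , z₁≢y₂)))
...     | yes refl = inj₂ (inj₂ (inj₂ (inj₂ (refl , refl , refl))))

distinct₃ : ∀ {c} {x y z : Fin c} → x ≢ y → x ≢ z → y ≢ z → PairwiseDistinct (x ∷ y ∷ z ∷ [])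
distinct₃ x≢y x≢z y≢z 0F 1F _ = x≢y
distinct₃ x≢y x≢z y≢z 0F 2F _ = x≢z
distinct₃ x≢y x≢z y≢z 1F 0F _ = ≢-sym x≢y
distinct₃ x≢y x≢z y≢z 1F 2F _ = y≢z
distinct₃ x≢y x≢z y≢z 2F 0F _ = ≢-sym x≢z
distinct₃ x≢y x≢z y≢z 2F 1F _ = ≢-sym y≢z
distinct₃ x≢y x≢z y≢z 0F 0F 0≢0 = contradiction refl 0≢0
distinct₃ x≢y x≢z y≢z 1F 1F 1≢1 = contradiction refl 1≢1
distinct₃ x≢y x≢z y≢z 2F 2F 2≢2 = contradiction refl 2≢2

-- Throughout, π relabels the pegs: slot t stands for peg π t, slot 0 is the
-- peg where the (⋆,1,1)-question is ⋆, and columns live on slots 1 and 2.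
module ThreePegs {c} {St : Strategy 3 c} (feasible : Feasible St) (5≤c : 5 ≤ c) where

  open Contributions St

  OwnsOffStar : Permutation′ 3 → Tuple 3 c → Set
  OwnsOffStar π Q = Owns (π ⟨$⟩ʳ 1F) (lookup Q (π ⟨$⟩ʳ 1F)) Q × Owns (π ⟨$⟩ʳ 2F) (lookup Q (π ⟨$⟩ʳ 2F)) Q

  star-question-owns-off-star : ∀ {Q} →
    IsTypeQuestion St (nothing ∷ just 1 ∷ just 1 ∷ []) Q ⊎ IsTypeQuestion St (just 1 ∷ nothing ∷ just 1 ∷ []) Q
      ⊎ IsTypeQuestion St (just 1 ∷ just 1 ∷ nothing ∷ []) Q →
    ∃ λ π → OwnsOffStar π Q
  star-question-owns-off-star (inj₁ (Q∈ , occurrences)) =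
    id , occ≡1⇒owns Q∈ (occurrences 1F 1 refl) , occ≡1⇒owns Q∈ (occurrences 2F 1 refl)
  star-question-owns-off-star (inj₂ (inj₁ (Q∈ , occurrences))) =
    transpose 0F 1F , occ≡1⇒owns Q∈ (occurrences 0F 1 refl) , occ≡1⇒owns Q∈ (occurrences 2F 1 refl)
  star-question-owns-off-star (inj₂ (inj₂ (Q∈ , occurrences))) =
    transpose 0F 2F , occ≡1⇒owns Q∈ (occurrences 1F 1 refl) , occ≡1⇒owns Q∈ (occurrences 0F 1 refl)

  row-owns-off-star : ∀ {R} → OwnsRow R → OwnsOffStar id R
  row-owns-off-star R-owns = R-owns 1F , R-owns 2F

  row-≢ : (π : Permutation′ 3) {s s' : Fin 3} {x y : Fin c} {R : Tuple 3 c} →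
    Owns (π ⟨$⟩ʳ s) x R → Owns (π ⟨$⟩ʳ s') y R → s ≢ s' → x ≢ y
  row-≢ π o o' s≢s' = owned-row-≢ o o' (s≢s' ∘ ⟨$⟩ʳ-injective π)

  swappable-columns-⊥ : (π : Permutation′ 3) {x₁ x₂ y₁ y₂ : Fin c} →
    Alike (π ⟨$⟩ʳ 1F) x₁ (π ⟨$⟩ʳ 2F) x₂ → Alike (π ⟨$⟩ʳ 1F) y₁ (π ⟨$⟩ʳ 2F) y₂ →
    x₁ ≢ y₁ → Swappable (x₁ , x₂) (y₁ , y₂) → ⊥
  swappable-columns-⊥ π {x₁} {x₂} {y₁} {y₂} x-alike y-alike x₁≢y₁ (x₁≢y₂ , y₁≢x₂)
    with fresh (x₁ ∷ x₂ ∷ y₁ ∷ y₂ ∷ []) 5≤c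
  ... | z , z≢x₁ ∷ z≢x₂ ∷ z≢y₁ ∷ z≢y₂ ∷ [] =
    x₁≢y₁ (cong (λ s → lookup s 1F) (alike-secrets-≡ feasible π (transpose 1F 2F)
      {z ∷ x₁ ∷ y₂ ∷ []} {z ∷ y₁ ∷ x₂ ∷ []}
      (distinct₃ z≢x₁ z≢y₂ x₁≢y₂) (distinct₃ z≢y₁ z≢x₂ y₁≢x₂)
      λ { 0F → λ _ → refl ; 1F → x-alike ; 2F → alike-sym y-alike }))

  cyclic-two-rows-⊥ : (π : Permutation′ 3) {X Y : Tuple 3 c} {x₀ x₁ x₂ y₀ y₁ y₂ z₁ z₂ : Fin c} →
    Owns (π ⟨$⟩ʳ 0F) x₀ X → Owns (π ⟨$⟩ʳ 1F) x₁ X → Owns (π ⟨$⟩ʳ 2F) x₂ X →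
    Owns (π ⟨$⟩ʳ 0F) y₀ Y → Owns (π ⟨$⟩ʳ 1F) y₁ Y → Owns (π ⟨$⟩ʳ 2F) y₂ Y →
    Alike (π ⟨$⟩ʳ 1F) z₁ (π ⟨$⟩ʳ 2F) z₂ → X ≢ Y → Cyclic (x₁ , x₂) (y₁ , y₂) (z₁ , z₂) → ⊥
  cyclic-two-rows-⊥ π {x₀ = x₀} {x₁} {x₂} {y₀} {y₁} X₀ X₁ X₂ Y₀ Y₁ Y₂ z-alike X≢Y (refl , refl , refl) =
    owners-≢ X₀ Y₀ X≢Y (cong (λ s → lookup s 0F) (alike-secrets-≡ feasible π (transpose 1F 2F ∘ₚ transpose 0F 1F)
      {x₀ ∷ x₂ ∷ x₁ ∷ []} {y₀ ∷ x₁ ∷ y₁ ∷ []}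
      (distinct₃ (row-≢ π X₀ X₂ λ ()) (row-≢ π X₀ X₁ λ ()) (row-≢ π X₂ X₁ λ ()))
      (distinct₃ (row-≢ π Y₀ Y₂ λ ()) (row-≢ π Y₀ Y₁ λ ()) (row-≢ π Y₂ Y₁ λ ()))
      λ { 0F → owns-alike X₀ X₁ ; 1F → z-alike ; 2F → owns-alike Y₂ Y₀ }))

  cyclic-row-with-absents-⊥ : (π : Permutation′ 3) {A : Tuple 3 c} {a₀ a₁ a₂ q₁ q₂ u₀ u₁ u₂ : Fin c} →
    Owns (π ⟨$⟩ʳ 0F) a₀ A → Owns (π ⟨$⟩ʳ 1F) a₁ A → Owns (π ⟨$⟩ʳ 2F) a₂ A →
    Alike (π ⟨$⟩ʳ 1F) q₁ (π ⟨$⟩ʳ 2F) q₂ →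
    ¬ Occurs St (π ⟨$⟩ʳ 0F) u₀ → ¬ Occurs St (π ⟨$⟩ʳ 1F) u₁ → ¬ Occurs St (π ⟨$⟩ʳ 2F) u₂ →
    Cyclic (a₁ , a₂) (q₁ , q₂) (u₁ , u₂) → ⊥
  cyclic-row-with-absents-⊥ π {a₀ = a₀} {a₁} {a₂} {q₁} {u₀ = u₀} A₀ A₁ A₂ q-alike U₀ U₁ U₂ (refl , refl , refl)
    with a₂ ≟ u₀ | a₀ ≟ q₁
  ... | yes refl | _ with fresh (a₀ ∷ a₁ ∷ a₂ ∷ []) (≤-trans (n≤1+n 4) 5≤c)
  ...   | z , z≢a₀ ∷ z≢a₁ ∷ z≢a₂ ∷ [] =
    row-≢ π A₀ A₂ (λ ()) (cong (λ s → lookup s 0F) (alike-secrets-≡ feasible π (transpose 0F 1F)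
      {a₀ ∷ a₂ ∷ z ∷ []} {a₂ ∷ a₁ ∷ z ∷ []}
      (distinct₃ (row-≢ π A₀ A₂ λ ()) (≢-sym z≢a₀) (≢-sym z≢a₂))
      (distinct₃ (row-≢ π A₂ A₁ λ ()) (≢-sym z≢a₂) (≢-sym z≢a₁))
      λ { 0F → owns-alike A₀ A₁ ; 1F → absent-alike U₁ U₀ ; 2F → λ _ → refl }))
  cyclic-row-with-absents-⊥ π {a₀ = a₀} {a₁} {a₂} {q₁} {u₀ = u₀} A₀ A₁ A₂ q-alike U₀ U₁ U₂ (refl , refl , refl)
    | no a₂≢u₀ | yes refl =
    owned-≢-absent A₀ U₀ (cong (λ s → lookup s 0F) (alike-secrets-≡ feasible π (transpose 0F 1F ∘ₚ transpose 1F 2F)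
      {a₀ ∷ a₂ ∷ a₁ ∷ []} {u₀ ∷ a₀ ∷ a₂ ∷ []}
      (distinct₃ (row-≢ π A₀ A₂ λ ()) (row-≢ π A₀ A₁ λ ()) (row-≢ π A₂ A₁ λ ()))
      (distinct₃ (≢-sym (owned-≢-absent A₀ U₀)) (≢-sym a₂≢u₀) (row-≢ π A₀ A₂ λ ()))
      λ { 0F → owns-alike A₀ A₂ ; 1F → absent-alike U₁ U₀ ; 2F → alike-sym q-alike }))
  cyclic-row-with-absents-⊥ π {a₀ = a₀} {a₁} {a₂} {q₁} {u₀ = u₀} A₀ A₁ A₂ q-alike U₀ U₁ U₂ (refl , refl , refl)
    | no a₂≢u₀ | no a₀≢q₁ with fresh (a₀ ∷ q₁ ∷ u₀ ∷ a₂ ∷ []) 5≤c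
  ... | z , z≢a₀ ∷ z≢q₁ ∷ z≢u₀ ∷ z≢a₂ ∷ [] =
    owned-≢-absent A₀ U₀ (cong (λ s → lookup s 0F) (alike-secrets-≡ feasible π (transpose 0F 2F)
      {a₀ ∷ z ∷ q₁ ∷ []} {u₀ ∷ z ∷ a₂ ∷ []}
      (distinct₃ (≢-sym z≢a₀) a₀≢q₁ z≢q₁)
      (distinct₃ (≢-sym z≢u₀) (≢-sym a₂≢u₀) z≢a₂)
      λ { 0F → owns-alike A₀ A₂ ; 1F → λ _ → refl ; 2F → absent-alike U₂ U₀ }))

  star-beside-two-rows-⊥ : (π : Permutation′ 3) {A B Q : Tuple 3 c} → OwnsRow A → OwnsRow B → OwnsOffStar π Q →
    A ≢ B → A ≢ Q → B ≢ Q → ⊥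
  star-beside-two-rows-⊥ π A-owns B-owns (Q₁ , Q₂) A≢B A≢Q B≢Q =
    case swappable-or-cyclic _≟_ (owners-≢ A₁ Q₁ A≢Q) (owners-≢ B₁ Q₁ B≢Q) (owners-≢ B₂ Q₂ B≢Q) (row-≢ π A₁ A₂ λ ()) of λ
      { (inj₁ AB) → swappable-columns-⊥ π (owns-alike A₁ A₂) (owns-alike B₁ B₂) (owners-≢ A₁ B₁ A≢B) AB
      ; (inj₂ (inj₁ AQ)) → swappable-columns-⊥ π (owns-alike A₁ A₂) (owns-alike Q₁ Q₂) (owners-≢ A₁ Q₁ A≢Q) AQ
      ; (inj₂ (inj₂ (inj₁ BQ))) → swappable-columns-⊥ π (owns-alike B₁ B₂) (owns-alike Q₁ Q₂) (owners-≢ B₁ Q₁ B≢Q) BQ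
      ; (inj₂ (inj₂ (inj₂ (inj₁ ABQ)))) → cyclic-two-rows-⊥ π A₀ A₁ A₂ B₀ B₁ B₂ (owns-alike Q₁ Q₂) A≢B ABQ
      ; (inj₂ (inj₂ (inj₂ (inj₂ (a≡q , q≡b , b≡a))))) →
          cyclic-two-rows-⊥ π B₀ B₁ B₂ A₀ A₁ A₂ (owns-alike Q₁ Q₂) (≢-sym A≢B) (b≡a , a≡q , q≡b)
      }
    where
    A₀ = A-owns (π ⟨$⟩ʳ 0F)
    A₁ = A-owns (π ⟨$⟩ʳ 1F)
    A₂ = A-owns (π ⟨$⟩ʳ 2F)
    B₀ = B-owns (π ⟨$⟩ʳ 0F)
    B₁ = B-owns (π ⟨$⟩ʳ 1F)
    B₂ = B-owns (π ⟨$⟩ʳ 2F)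

  star-beside-row-with-absents-⊥ : (π : Permutation′ 3) {A Q : Tuple 3 c} {u : Fin 3 → Fin c} →
    OwnsRow A → OwnsOffStar π Q → (∀ t → ¬ Occurs St t (u t)) → A ≢ Q → ⊥
  star-beside-row-with-absents-⊥ π A-owns (Q₁ , Q₂) absent A≢Q =
    case swappable-or-cyclic _≟_ (owned-≢-absent A₁ U₁) (owned-≢-absent Q₁ U₁) (owned-≢-absent Q₂ U₂) (row-≢ π A₁ A₂ λ ()) of λ
      { (inj₁ AQ) → swappable-columns-⊥ π (owns-alike A₁ A₂) (owns-alike Q₁ Q₂) (owners-≢ A₁ Q₁ A≢Q) AQ
      ; (inj₂ (inj₁ AU)) → swappable-columns-⊥ π (owns-alike A₁ A₂) (absent-alike U₁ U₂) (owned-≢-absent A₁ U₁) AU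
      ; (inj₂ (inj₂ (inj₁ QU))) → swappable-columns-⊥ π (owns-alike Q₁ Q₂) (absent-alike U₁ U₂) (owned-≢-absent Q₁ U₁) QU
      ; (inj₂ (inj₂ (inj₂ (inj₁ AQU)))) → cyclic-row-with-absents-⊥ π A₀ A₁ A₂ (owns-alike Q₁ Q₂) U₀ U₁ U₂ AQU
      ; (inj₂ (inj₂ (inj₂ (inj₂ (a≡u , u≡q , q≡a))))) →
          cyclic-row-with-absents-⊥ (transpose 1F 2F ∘ₚ π) A₀ A₂ A₁ (owns-alike Q₂ Q₁) U₀ U₂ U₁
            (sym q≡a , sym u≡q , sym a≡u)
      }
    where
    A₀ = A-owns (π ⟨$⟩ʳ 0F)
    A₁ = A-owns (π ⟨$⟩ʳ 1F)
    A₂ = A-owns (π ⟨$⟩ʳ 2F)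
    U₀ = absent (π ⟨$⟩ʳ 0F)
    U₁ = absent (π ⟨$⟩ʳ 1F)
    U₂ = absent (π ⟨$⟩ʳ 2F)

lemma3 : ∀ (c : ℕ) → 5 ≤ c → ∀ (St : Strategy 3 c) → Feasible St →
  -- (a)
  (∀ Q₁ Q₂ Q → Q₁ ≢ Q₂ →
    IsTypeQuestion St (just 1 ∷ just 1 ∷ just 1 ∷ []) Q₁ →
    IsTypeQuestion St (just 1 ∷ just 1 ∷ just 1 ∷ []) Q₂ →
    Q ∈ questions St → Q ≢ Q₁ → Q ≢ Q₂ →
    ¬ (IsTypeQuestion St (nothing ∷ just 1 ∷ just 1 ∷ []) Q
       ⊎ IsTypeQuestion St (just 1 ∷ nothing ∷ just 1 ∷ []) Q
       ⊎ IsTypeQuestion St (just 1 ∷ just 1 ∷ nothing ∷ []) Q))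
  ×
  -- (b)
  (∀ Q₁ Q₂ Q₃ → Q₁ ≢ Q₂ → Q₁ ≢ Q₃ → Q₂ ≢ Q₃ →
    IsTypeQuestion St (just 1 ∷ just 1 ∷ just 1 ∷ []) Q₁ →
    IsTypeQuestion St (just 1 ∷ just 1 ∷ just 1 ∷ []) Q₂ →
    IsTypeQuestion St (just 1 ∷ just 1 ∷ just 1 ∷ []) Q₃ → ⊥)
  ×
  -- (c)
  ((∀ (i : Fin 3) → ∃ λ x → ¬ Occurs St i x) →
   ∀ Q₁ Q →
    IsTypeQuestion St (just 1 ∷ just 1 ∷ just 1 ∷ []) Q₁ →
    Q ∈ questions St → Q ≢ Q₁ →
    ¬ (IsTypeQuestion St (nothing ∷ just 1 ∷ just 1 ∷ []) Q
       ⊎ IsTypeQuestion St (just 1 ∷ nothing ∷ just 1 ∷ []) Q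
       ⊎ IsTypeQuestion St (just 1 ∷ just 1 ∷ nothing ∷ []) Q))
  ×
  -- (d)
  ((∀ (i : Fin 3) → ∃ λ x → ¬ Occurs St i x) →
   ∀ Q₁ Q₂ → Q₁ ≢ Q₂ →
    IsTypeQuestion St (just 1 ∷ just 1 ∷ just 1 ∷ []) Q₁ →
    IsTypeQuestion St (just 1 ∷ just 1 ∷ just 1 ∷ []) Q₂ → ⊥)
lemma3 c 5≤c St feasible =
  (λ A B Q A≢B A-type B-type _ Q≢A Q≢B Q-type →
    let π , Q-owns = star-question-owns-off-star Q-type in
    star-beside-two-rows-⊥ π (ones-question-owns-row A-type) (ones-question-owns-row B-type) Q-owns
      A≢B (≢-sym Q≢A) (≢-sym Q≢B)) ,
  (λ A B Q A≢B A≢Q B≢Q A-type B-type Q-type →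
    star-beside-two-rows-⊥ id (ones-question-owns-row A-type) (ones-question-owns-row B-type)
      (row-owns-off-star (ones-question-owns-row Q-type)) A≢B A≢Q B≢Q) ,
  (λ absent A Q A-type _ Q≢A Q-type →
    let π , Q-owns = star-question-owns-off-star Q-type in
    star-beside-row-with-absents-⊥ π (ones-question-owns-row A-type) Q-owns (proj₂ ∘ absent) (≢-sym Q≢A)) ,
  (λ absent A Q A≢Q A-type Q-type →
    star-beside-row-with-absents-⊥ id (ones-question-owns-row A-type)
      (row-owns-off-star (ones-question-owns-row Q-type)) (proj₂ ∘ absent) A≢Q)
  where
  open Contributions St
  open ThreePegs feasible 5≤c
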